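{- Let $T$ be a tree with odd diameter. Then the eigenvalues of the eccentricity matrix $\mathcal{E}(T)$ are symmetric about the origin: if $\lambda$ is an eigenvalue of $\mathcal{E}(T)$ with multiplicity $k$, then $-\lambda$ is also an eigenvalue of $\mathcal{E}(T)$ with multiplicity $k$.
   Context: For a connected graph $G$ with distance function $d(u,v)$, the eccentricity of a vertex $u$ is $e(u)=\max_{v}d(u,v)$. The eccentricity matrix $\mathcal{E}(G)$ is the matrix indexed by $V(G)$ with $\mathcal{E}(G)_{uv}=d(u,v)$ if $d(u,v)=\min\{e(u),e(v)\}$, and $\mathcal{E}(G)_{uv}=0$ otherwise. The diameter is the largest distance between two vertices. -}

module Defs where

open import Level using (Level; _⊔_) renaming (suc to lsuc)
open import Data.Nat as ℕ using (ℕ; zero; suc; _≤_; _⊓_)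
  renaming (_⊔_ to _⊔ℕ_)
open import Data.Nat.Properties using (_≟_)
open import Data.Fin using (Fin; zero; suc; punchIn)
open import Data.List using (List; []; _∷_; _++_; [_]; length; foldr)
open import Data.List.Relation.Unary.Unique.Propositional using (Unique)
open import Data.List.Relation.Unary.Linked using (Linked)
open import Data.Product using (Σ; ∃; _×_; _,_)
open import Data.Empty using (⊥)
open import Relation.Nullary using (¬_; yes; no)
open import Relation.Binary.PropositionalEquality using (_≡_)
open import Algebra.Bundles using (CommutativeRing)
import Data.Fin.Properties

record SimpleGraph (n : ℕ) : Set₁ where
  field
    Adj    : Fin n → Fin n → Set
    sym    : ∀ {u v} → Adj u v → Adj v u
    irrefl : ∀ {u} → ¬ Adj u u
open SimpleGraph public

module _ {n : ℕ} (G : SimpleGraph n) where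

  data Walk : Fin n → Fin n → ℕ → Set where
    nil  : ∀ {u} → Walk u u 0
    cons : ∀ {u w v k} → Adj G u w → Walk w v k → Walk u v (suc k)

  Connected : Set
  Connected = ∀ u v → ∃ λ k → Walk u v k

  IsCycle : List (Fin n) → Set
  IsCycle []       = ⊥
  IsCycle (v ∷ ws) =
    (2 ≤ length ws) × Unique (v ∷ ws) × Linked (Adj G) ((v ∷ ws) ++ [ v ])

  Acyclic : Set
  Acyclic = ∀ vs → ¬ IsCycle vs

  IsTree : Set
  IsTree = Connected × Acyclic

  IsDistance : (Fin n → Fin n → ℕ) → Set
  IsDistance d = ∀ u v → Walk u v (d u v) × (∀ k → Walk u v k → d u v ≤ k)

module _ {n : ℕ} where

  allV : List (Fin n)
  allV = Data.List.allFin n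
    where import Data.List

  ecc : (Fin n → Fin n → ℕ) → Fin n → ℕ
  ecc d u = foldr (λ v m → d u v ⊔ℕ m) 0 allV

  diam : (Fin n → Fin n → ℕ) → ℕ
  diam d = foldr (λ u m → ecc d u ⊔ℕ m) 0 allV

  eccMat : (Fin n → Fin n → ℕ) → Fin n → Fin n → ℕ
  eccMat d u v with d u v ≟ (ecc d u ⊓ ecc d v)
  ... | yes _ = d u v
  ... | no  _ = 0

data Odd : ℕ → Set where
  odd : ∀ m → Odd (suc (2 ℕ.* m))

record Field c ℓ : Set (lsuc (c ⊔ ℓ)) where
  field
    commutativeRing : CommutativeRing c ℓ
  open CommutativeRing commutativeRing public
  field
    1≉0     : ¬ (1# ≈ 0#)
    inverse : ∀ x → ¬ (x ≈ 0#) → ∃ λ y → (x * y) ≈ 1#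

module Poly {c ℓ : Level} (K : Field c ℓ) where
  open Field K using (Carrier; _≈_; _+_; _*_; -_; 0#; 1#)

  fromℕ : ℕ → Carrier
  fromℕ zero    = 0#
  fromℕ (suc m) = 1# + fromℕ m

  CharZero : Set ℓ
  CharZero = ∀ m → ¬ (fromℕ (suc m) ≈ 0#)

  -- polynomials: coefficient lists, lowest degree first
  Pol : Set c
  Pol = List Carrier

  coeff : Pol → ℕ → Carrier
  coeff []       _       = 0#
  coeff (a ∷ p)  zero    = a
  coeff (a ∷ p)  (suc i) = coeff p i

  _≈ₚ_ : Pol → Pol → Set ℓ
  p ≈ₚ q = ∀ i → coeff p i ≈ coeff q i

  _+ₚ_ : Pol → Pol → Pol
  []      +ₚ q       = q
  (a ∷ p) +ₚ []      = a ∷ p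
  (a ∷ p) +ₚ (b ∷ q) = (a + b) ∷ (p +ₚ q)

  _·ₚ_ : Carrier → Pol → Pol
  a ·ₚ []      = []
  a ·ₚ (b ∷ p) = (a * b) ∷ (a ·ₚ p)

  _*ₚ_ : Pol → Pol → Pol
  []      *ₚ q = []
  (a ∷ p) *ₚ q = (a ·ₚ q) +ₚ (0# ∷ (p *ₚ q))

  -ₚ_ : Pol → Pol
  -ₚ p = (- 1#) ·ₚ p

  _^ₚ_ : Pol → ℕ → Pol
  p ^ₚ zero  = 1# ∷ []
  p ^ₚ suc k = p *ₚ (p ^ₚ k)

  _∣ₚ_ : Pol → Pol → Set (c ⊔ ℓ)
  p ∣ₚ q = ∃ λ r → q ≈ₚ (p *ₚ r)

  X-_ : Carrier → Pol
  X- a = (- a) ∷ 1# ∷ []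

  det : ∀ {m} → (Fin m → Fin m → Pol) → Pol
  det {zero}  M = 1# ∷ []
  det {suc m} M = go 1# (Data.List.allFin (suc m))
    where
      import Data.List
      go : Carrier → List (Fin (suc m)) → Pol
      go s []       = []
      go s (j ∷ js) =
        (s ·ₚ (M zero j *ₚ det (λ i k → M (suc i) (punchIn j k))))
          +ₚ go (- s) js

  charPoly : ∀ {m} → (Fin m → Fin m → ℕ) → Pol
  charPoly {m} A = det λ i j → entry i j
    where
      entry : Fin m → Fin m → Pol
      entry i j with Data.Fin.Properties._≟_ i j
      ... | yes _ = (- fromℕ (A i j)) ∷ 1# ∷ []
      ... | no  _ = (- fromℕ (A i j)) ∷ []

  EigenvalueWithMultiplicity : ∀ {m} → (Fin m → Fin m → ℕ) → Carrier → ℕ → Set (c ⊔ ℓ)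
  EigenvalueWithMultiplicity A a k =
    (1 ≤ k) × ((X- a) ^ₚ k) ∣ₚ charPoly A × ¬ (((X- a) ^ₚ suc k) ∣ₚ charPoly A)

{-# OPTIONS --safe #-}
module Submission where

-- Write the odd diameter as 2r+1 and let ab be the middle edge of a diametral path from x to y, so
-- d(a,x) = d(b,y) = r. In a tree every vertex w is strictly closer to one of a, b; colour it by that side.
-- If u, v both lie on a's side then d(u,y) = d(u,a) + 1 + r, and the diameter bound applied to d(v,y)
-- gives d(a,v) ≤ r, so d(u,v) ≤ d(u,a) + r < d(u,y) ≤ e(u); symmetrically for b's side and for v.
-- Hence the eccentricity matrix E vanishes within each colour class. With s_i = ±1 the colour signs,
-- the entries of xI - E then satisfy (xI - E)_ij(-x) = -s_i s_j (xI - E)_ij(x), and taking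
-- determinants χ(-x) = c χ(x) for a constant c. So (x - λ)^k divides χ exactly when (x + λ)^k does.

open import Defs hiding (sym)
open import Level using (Level)
open import Data.Nat using (ℕ; zero; suc)
open import Data.Fin using (Fin; zero; suc; punchIn)
open import Data.List using (List; []; _∷_; tabulate)
open import Data.Bool using (Bool; true; false)
open import Data.Product using (Σ; _×_; _,_)
open import Data.Empty using (⊥-elim)
open import Relation.Nullary using (¬_; yes; no)
open import Relation.Binary.Bundles using (Setoid)
open import Relation.Binary.PropositionalEquality using (_≡_)
import Data.Bool as Bool
import Data.Fin.Properties as Fin
import Relation.Binary.PropositionalEquality as ≡
import Relation.Binary.Reasoning.Setoid as SetoidReasoning
import Algebra.Properties.Ring as RingProperties
import Algebra.Properties.CommutativeSemigroup as CommutativeSemigroupProperties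
import Algebra.Properties.CommutativeMonoid.Sum as CommutativeMonoidSum
import Algebra.Solver.CommutativeMonoid as CommutativeMonoidSolver
import Algebra.Definitions.RawSemiring as RawSemiringDefinitions
open import Algebra.Bundles using (Semiring)

Bipartite : ∀ {m} → (Fin m → Fin m → ℕ) → (Fin m → Bool) → Set
Bipartite A colour = ∀ i j → colour i ≡ colour j → A i j ≡ 0

module Polynomials {c ℓ : Level} (K : Field c ℓ) where

  open Field K hiding (zero)
  open Poly K
  open RingProperties ring using (-1*x≈-x; -‿distribˡ-*; -‿involutive; -0#≈0#)
  open CommutativeSemigroupProperties *-commutativeSemigroup using (x∙yz≈y∙xz)
  open RawSemiringDefinitions (Semiring.rawSemiring semiring) using (_^_)
  open CommutativeMonoidSum *-commutativeMonoid using (sum-remove)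
    renaming (sum to ∏)
  module ≈-Reasoning = SetoidReasoning setoid

  -- A record rather than _≈ₚ_ itself, so that Agda can infer both polynomials from a proof.
  infix 4 _≋_
  record _≋_ (p q : Pol) : Set ℓ where
    constructor mk≋
    field coeff-≈ : p ≈ₚ q
  open _≋_

  ≋-refl : ∀ {p} → p ≋ p
  ≋-refl = mk≋ λ _ → refl

  ≋-sym : ∀ {p q} → p ≋ q → q ≋ p
  ≋-sym (mk≋ e) = mk≋ λ i → sym (e i)

  ≋-trans : ∀ {p q r} → p ≋ q → q ≋ r → p ≋ r
  ≋-trans (mk≋ e) (mk≋ f) = mk≋ λ i → trans (e i) (f i)

  ≋-setoid : Setoid c ℓ
  ≋-setoid = record
    { Carrier = Pol ; _≈_ = _≋_
    ; isEquivalence = record { refl = ≋-refl ; sym = ≋-sym ; trans = ≋-trans } }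

  module ≋-Reasoning = SetoidReasoning ≋-setoid

  ∷-cong : ∀ {a b p q} → a ≈ b → p ≋ q → (a ∷ p) ≋ (b ∷ q)
  ∷-cong a≈b (mk≋ e) = mk≋ λ { zero → a≈b ; (suc i) → e i }

  ∷-head : ∀ {a b p q} → (a ∷ p) ≋ (b ∷ q) → a ≈ b
  ∷-head (mk≋ e) = e zero

  ∷-tail : ∀ {a b p q} → (a ∷ p) ≋ (b ∷ q) → p ≋ q
  ∷-tail (mk≋ e) = mk≋ λ i → e (suc i)

  coeff-+ₚ : ∀ p q i → coeff (p +ₚ q) i ≈ coeff p i + coeff q i
  coeff-+ₚ []      q       i       = sym (+-identityˡ _)
  coeff-+ₚ (a ∷ p) []      i       = sym (+-identityʳ _)
  coeff-+ₚ (a ∷ p) (b ∷ q) zero    = refl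
  coeff-+ₚ (a ∷ p) (b ∷ q) (suc i) = coeff-+ₚ p q i

  coeff-·ₚ : ∀ a p i → coeff (a ·ₚ p) i ≈ a * coeff p i
  coeff-·ₚ a []      i       = sym (zeroʳ a)
  coeff-·ₚ a (b ∷ p) zero    = refl
  coeff-·ₚ a (b ∷ p) (suc i) = coeff-·ₚ a p i

  +ₚ-cong : ∀ {p p' q q'} → p ≋ p' → q ≋ q' → (p +ₚ q) ≋ (p' +ₚ q')
  +ₚ-cong {p} {p'} {q} {q'} (mk≋ e) (mk≋ f) = mk≋ λ i → begin
    coeff (p +ₚ q) i         ≈⟨ coeff-+ₚ p q i ⟩
    coeff p i + coeff q i    ≈⟨ +-cong (e i) (f i) ⟩
    coeff p' i + coeff q' i  ≈⟨ coeff-+ₚ p' q' i ⟨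
    coeff (p' +ₚ q') i       ∎
    where open ≈-Reasoning

  ·ₚ-cong : ∀ {a b p q} → a ≈ b → p ≋ q → (a ·ₚ p) ≋ (b ·ₚ q)
  ·ₚ-cong {a} {b} {p} {q} a≈b (mk≋ e) = mk≋ λ i → begin
    coeff (a ·ₚ p) i  ≈⟨ coeff-·ₚ a p i ⟩
    a * coeff p i     ≈⟨ *-cong a≈b (e i) ⟩
    b * coeff q i     ≈⟨ coeff-·ₚ b q i ⟨
    coeff (b ·ₚ q) i  ∎
    where open ≈-Reasoning

  ·ₚ-congˡ : ∀ a {p q} → p ≋ q → (a ·ₚ p) ≋ (a ·ₚ q)
  ·ₚ-congˡ a = ·ₚ-cong refl

  ·ₚ-distrib-+ₚ : ∀ a p q → (a ·ₚ (p +ₚ q)) ≋ ((a ·ₚ p) +ₚ (a ·ₚ q))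
  ·ₚ-distrib-+ₚ a p q = mk≋ λ i → begin
    coeff (a ·ₚ (p +ₚ q)) i                ≈⟨ coeff-·ₚ a (p +ₚ q) i ⟩
    a * coeff (p +ₚ q) i                   ≈⟨ *-congˡ (coeff-+ₚ p q i) ⟩
    a * (coeff p i + coeff q i)            ≈⟨ distribˡ a _ _ ⟩
    a * coeff p i + a * coeff q i          ≈⟨ +-cong (coeff-·ₚ a p i) (coeff-·ₚ a q i) ⟨
    coeff (a ·ₚ p) i + coeff (a ·ₚ q) i    ≈⟨ coeff-+ₚ (a ·ₚ p) (a ·ₚ q) i ⟨
    coeff ((a ·ₚ p) +ₚ (a ·ₚ q)) i         ∎
    where open ≈-Reasoning

  ·ₚ-assoc : ∀ a b p → (a ·ₚ (b ·ₚ p)) ≋ ((a * b) ·ₚ p)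
  ·ₚ-assoc a b p = mk≋ λ i → begin
    coeff (a ·ₚ (b ·ₚ p)) i  ≈⟨ coeff-·ₚ a (b ·ₚ p) i ⟩
    a * coeff (b ·ₚ p) i     ≈⟨ *-congˡ (coeff-·ₚ b p i) ⟩
    a * (b * coeff p i)      ≈⟨ *-assoc a b _ ⟨
    (a * b) * coeff p i      ≈⟨ coeff-·ₚ (a * b) p i ⟨
    coeff ((a * b) ·ₚ p) i   ∎
    where open ≈-Reasoning

  ·ₚ-zeroˡ : ∀ {a} p → a ≈ 0# → (a ·ₚ p) ≋ []
  ·ₚ-zeroˡ {a} p a≈0 = mk≋ λ i → trans (coeff-·ₚ a p i) (trans (*-congʳ a≈0) (zeroˡ _))

  0#∷-≋[] : ∀ {p} → p ≋ [] → (0# ∷ p) ≋ []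
  0#∷-≋[] (mk≋ e) = mk≋ λ { zero → refl ; (suc i) → e i }

  ∷-≋[]⁻ : ∀ {a p} → (a ∷ p) ≋ [] → a ≈ 0# × p ≋ []
  ∷-≋[]⁻ (mk≋ e) = e zero , mk≋ λ i → e (suc i)

  +ₚ-≋[]ˡ : ∀ {p q} → p ≋ [] → (p +ₚ q) ≋ q
  +ₚ-≋[]ˡ {p} {q} (mk≋ e) = mk≋ λ i → trans (coeff-+ₚ p q i) (trans (+-congʳ (e i)) (+-identityˡ _))

  *ₚ-congʳ : ∀ p {q q'} → q ≋ q' → (p *ₚ q) ≋ (p *ₚ q')
  *ₚ-congʳ []      q≋q' = ≋-refl
  *ₚ-congʳ (a ∷ p) q≋q' = +ₚ-cong (·ₚ-congˡ a q≋q') (∷-cong refl (*ₚ-congʳ p q≋q'))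

  *ₚ-zeroˡ : ∀ {p} q → p ≋ [] → (p *ₚ q) ≋ []
  *ₚ-zeroˡ {[]}    q p≋0 = ≋-refl
  *ₚ-zeroˡ {a ∷ p} q ap≋0 with ∷-≋[]⁻ ap≋0
  ... | a≈0 , p≋0 = ≋-trans (+ₚ-≋[]ˡ (·ₚ-zeroˡ q a≈0)) (0#∷-≋[] (*ₚ-zeroˡ q p≋0))

  *ₚ-congˡ : ∀ {p p'} q → p ≋ p' → (p *ₚ q) ≋ (p' *ₚ q)
  *ₚ-congˡ {a ∷ p} {b ∷ p'} q p≋p' =
    +ₚ-cong (·ₚ-cong (∷-head p≋p') ≋-refl) (∷-cong refl (*ₚ-congˡ q (∷-tail p≋p')))
  *ₚ-congˡ {[]}    {p'} q p≋p' = ≋-sym (*ₚ-zeroˡ q (≋-sym p≋p'))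
  *ₚ-congˡ {a ∷ p} {[]} q p≋p' = *ₚ-zeroˡ q p≋p'

  *ₚ-·ₚˡ : ∀ a p q → ((a ·ₚ p) *ₚ q) ≋ (a ·ₚ (p *ₚ q))
  *ₚ-·ₚˡ a []      q = ≋-refl
  *ₚ-·ₚˡ a (b ∷ p) q = begin
    ((a * b) ·ₚ q) +ₚ (0# ∷ ((a ·ₚ p) *ₚ q))      ≈⟨ +ₚ-cong (≋-sym (·ₚ-assoc a b q)) (∷-cong (sym (zeroʳ a)) (*ₚ-·ₚˡ a p q)) ⟩
    (a ·ₚ (b ·ₚ q)) +ₚ (a ·ₚ (0# ∷ (p *ₚ q)))     ≈⟨ ·ₚ-distrib-+ₚ a (b ·ₚ q) (0# ∷ (p *ₚ q)) ⟨
    a ·ₚ ((b ·ₚ q) +ₚ (0# ∷ (p *ₚ q)))            ∎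
    where open ≋-Reasoning

  *ₚ-·ₚʳ : ∀ a p q → (p *ₚ (a ·ₚ q)) ≋ (a ·ₚ (p *ₚ q))
  *ₚ-·ₚʳ a []      q = ≋-refl
  *ₚ-·ₚʳ a (b ∷ p) q = begin
    (b ·ₚ (a ·ₚ q)) +ₚ (0# ∷ (p *ₚ (a ·ₚ q)))     ≈⟨ +ₚ-cong (·ₚ-assoc b a q) (∷-cong (sym (zeroʳ a)) (*ₚ-·ₚʳ a p q)) ⟩
    ((b * a) ·ₚ q) +ₚ (a ·ₚ (0# ∷ (p *ₚ q)))      ≈⟨ +ₚ-cong (≋-trans (·ₚ-cong (*-comm b a) ≋-refl) (≋-sym (·ₚ-assoc a b q))) ≋-refl ⟩
    (a ·ₚ (b ·ₚ q)) +ₚ (a ·ₚ (0# ∷ (p *ₚ q)))     ≈⟨ ·ₚ-distrib-+ₚ a (b ·ₚ q) (0# ∷ (p *ₚ q)) ⟨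
    a ·ₚ ((b ·ₚ q) +ₚ (0# ∷ (p *ₚ q)))            ∎
    where open ≋-Reasoning

  *ₚ-·ₚ : ∀ a b p q → ((a ·ₚ p) *ₚ (b ·ₚ q)) ≋ ((a * b) ·ₚ (p *ₚ q))
  *ₚ-·ₚ a b p q = begin
    (a ·ₚ p) *ₚ (b ·ₚ q)  ≈⟨ *ₚ-·ₚˡ a p (b ·ₚ q) ⟩
    a ·ₚ (p *ₚ (b ·ₚ q))  ≈⟨ ·ₚ-congˡ a (*ₚ-·ₚʳ b p q) ⟩
    a ·ₚ (b ·ₚ (p *ₚ q))  ≈⟨ ·ₚ-assoc a b (p *ₚ q) ⟩
    (a * b) ·ₚ (p *ₚ q)   ∎
    where open ≋-Reasoning

  ^ₚ-cong : ∀ {p q} j → p ≋ q → (p ^ₚ j) ≋ (q ^ₚ j)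
  ^ₚ-cong zero    p≋q = ≋-refl
  ^ₚ-cong {p} {q} (suc j) p≋q = ≋-trans (*ₚ-congˡ (p ^ₚ j) p≋q) (*ₚ-congʳ q (^ₚ-cong j p≋q))

  ·ₚ-^ₚ : ∀ a p j → ((a ·ₚ p) ^ₚ j) ≋ ((a ^ j) ·ₚ (p ^ₚ j))
  ·ₚ-^ₚ a p zero    = ∷-cong (sym (*-identityʳ 1#)) ≋-refl
  ·ₚ-^ₚ a p (suc j) = ≋-trans (*ₚ-congʳ (a ·ₚ p) (·ₚ-^ₚ a p j)) (*ₚ-·ₚ a (a ^ j) p (p ^ₚ j))

  ∣ₚ-respˡ : ∀ {q q' p} → q ≋ q' → q ∣ₚ p → q' ∣ₚ p
  ∣ₚ-respˡ {q} {p = p} q≋q' (r , p≈qr) = r , coeff-≈ (≋-trans (mk≋ {p} {q *ₚ r} p≈qr) (*ₚ-congˡ r q≋q'))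

  -- reflect p is p(-x).
  reflect : Pol → Pol
  reflect []      = []
  reflect (a ∷ p) = a ∷ ((- 1#) ·ₚ reflect p)

  coeff-reflect : ∀ p i → coeff (reflect p) i ≈ ((- 1#) ^ i) * coeff p i
  coeff-reflect []      i       = sym (zeroʳ _)
  coeff-reflect (a ∷ p) zero    = sym (*-identityˡ a)
  coeff-reflect (a ∷ p) (suc i) = begin
    coeff ((- 1#) ·ₚ reflect p) i        ≈⟨ coeff-·ₚ (- 1#) (reflect p) i ⟩
    (- 1#) * coeff (reflect p) i         ≈⟨ *-congˡ (coeff-reflect p i) ⟩
    (- 1#) * (((- 1#) ^ i) * coeff p i)  ≈⟨ *-assoc _ _ _ ⟨
    ((- 1#) ^ suc i) * coeff p i         ∎
    where open ≈-Reasoning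

  reflect-cong : ∀ {p q} → p ≋ q → reflect p ≋ reflect q
  reflect-cong {p} {q} (mk≋ e) = mk≋ λ i →
    trans (coeff-reflect p i) (trans (*-congˡ (e i)) (sym (coeff-reflect q i)))

  reflect-+ₚ : ∀ p q → reflect (p +ₚ q) ≋ (reflect p +ₚ reflect q)
  reflect-+ₚ p q = mk≋ λ i → begin
    coeff (reflect (p +ₚ q)) i                  ≈⟨ coeff-reflect (p +ₚ q) i ⟩
    s i * coeff (p +ₚ q) i                      ≈⟨ *-congˡ (coeff-+ₚ p q i) ⟩
    s i * (coeff p i + coeff q i)               ≈⟨ distribˡ _ _ _ ⟩
    s i * coeff p i + s i * coeff q i           ≈⟨ +-cong (coeff-reflect p i) (coeff-reflect q i) ⟨
    coeff (reflect p) i + coeff (reflect q) i   ≈⟨ coeff-+ₚ (reflect p) (reflect q) i ⟨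
    coeff (reflect p +ₚ reflect q) i            ∎
    where
      open ≈-Reasoning
      s : ℕ → Carrier
      s i = (- 1#) ^ i

  reflect-·ₚ : ∀ a p → reflect (a ·ₚ p) ≋ (a ·ₚ reflect p)
  reflect-·ₚ a p = mk≋ λ i → begin
    coeff (reflect (a ·ₚ p)) i  ≈⟨ coeff-reflect (a ·ₚ p) i ⟩
    s i * coeff (a ·ₚ p) i      ≈⟨ *-congˡ (coeff-·ₚ a p i) ⟩
    s i * (a * coeff p i)       ≈⟨ x∙yz≈y∙xz _ _ _ ⟩
    a * (s i * coeff p i)       ≈⟨ *-congˡ (coeff-reflect p i) ⟨
    a * coeff (reflect p) i     ≈⟨ coeff-·ₚ a (reflect p) i ⟨
    coeff (a ·ₚ reflect p) i    ∎
    where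
      open ≈-Reasoning
      s : ℕ → Carrier
      s i = (- 1#) ^ i

  reflect-*ₚ : ∀ p q → reflect (p *ₚ q) ≋ (reflect p *ₚ reflect q)
  reflect-*ₚ []      q = ≋-refl
  reflect-*ₚ (a ∷ p) q = begin
    reflect ((a ·ₚ q) +ₚ (0# ∷ (p *ₚ q)))                      ≈⟨ reflect-+ₚ (a ·ₚ q) (0# ∷ (p *ₚ q)) ⟩
    reflect (a ·ₚ q) +ₚ (0# ∷ ((- 1#) ·ₚ reflect (p *ₚ q)))    ≈⟨ +ₚ-cong (reflect-·ₚ a q) (∷-cong refl (·ₚ-congˡ (- 1#) (reflect-*ₚ p q))) ⟩
    (a ·ₚ reflect q) +ₚ (0# ∷ ((- 1#) ·ₚ (reflect p *ₚ reflect q)))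
      ≈⟨ +ₚ-cong ≋-refl (∷-cong refl (≋-sym (*ₚ-·ₚˡ (- 1#) (reflect p) (reflect q)))) ⟩
    (a ·ₚ reflect q) +ₚ (0# ∷ (((- 1#) ·ₚ reflect p) *ₚ reflect q))  ∎
    where open ≋-Reasoning

  reflect-^ₚ : ∀ p j → reflect (p ^ₚ j) ≋ (reflect p ^ₚ j)
  reflect-^ₚ p zero    = ≋-refl
  reflect-^ₚ p (suc j) = ≋-trans (reflect-*ₚ p (p ^ₚ j)) (*ₚ-congʳ (reflect p) (reflect-^ₚ p j))

  reflect-X- : ∀ a → reflect (X- a) ≋ ((- 1#) ·ₚ (X- (- a)))
  reflect-X- a = ∷-cong (sym (trans (-1*x≈-x _) (-‿involutive (- a)))) ≋-refl

  ∣ₚ-reflect : ∀ {p} c → p ≋ (c ·ₚ reflect p) → ∀ a j → ((X- a) ^ₚ j) ∣ₚ p → ((X- (- a)) ^ₚ j) ∣ₚ p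
  ∣ₚ-reflect {p} c p≋c·p⁻ a j (r , p≈Yr) = c ·ₚ (((- 1#) ^ j) ·ₚ reflect r) , coeff-≈ (begin
    p                                             ≈⟨ p≋c·p⁻ ⟩
    c ·ₚ reflect p                                ≈⟨ ·ₚ-congˡ c (reflect-cong (mk≋ {p} {(Y ^ₚ j) *ₚ r} p≈Yr)) ⟩
    c ·ₚ reflect ((Y ^ₚ j) *ₚ r)                  ≈⟨ ·ₚ-congˡ c (reflect-*ₚ (Y ^ₚ j) r) ⟩
    c ·ₚ (reflect (Y ^ₚ j) *ₚ reflect r)          ≈⟨ ·ₚ-congˡ c (*ₚ-congˡ (reflect r) reflect-Y^j) ⟩
    c ·ₚ ((s ·ₚ (Y' ^ₚ j)) *ₚ reflect r)          ≈⟨ ·ₚ-congˡ c (*ₚ-·ₚˡ s (Y' ^ₚ j) (reflect r)) ⟩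
    c ·ₚ (s ·ₚ ((Y' ^ₚ j) *ₚ reflect r))          ≈⟨ ·ₚ-congˡ c (*ₚ-·ₚʳ s (Y' ^ₚ j) (reflect r)) ⟨
    c ·ₚ ((Y' ^ₚ j) *ₚ (s ·ₚ reflect r))          ≈⟨ *ₚ-·ₚʳ c (Y' ^ₚ j) (s ·ₚ reflect r) ⟨
    (Y' ^ₚ j) *ₚ (c ·ₚ (s ·ₚ reflect r))          ∎)
    where
      open ≋-Reasoning
      Y Y' : Pol
      Y  = X- a
      Y' = X- (- a)
      s : Carrier
      s = (- 1#) ^ j
      reflect-Y^j : reflect (Y ^ₚ j) ≋ (s ·ₚ (Y' ^ₚ j))
      reflect-Y^j = ≋-trans (reflect-^ₚ Y j) (≋-trans (^ₚ-cong j (reflect-X- a)) (·ₚ-^ₚ (- 1#) Y' j))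

  minor : ∀ {a} {A : Set a} {m} → (Fin (suc m) → Fin (suc m) → A) → Fin (suc m) → Fin m → Fin m → A
  minor M j i k = M (suc i) (punchIn j k)

  +ₚ-reflect : ∀ C {p p' q q'} → p ≋ (C ·ₚ reflect p') → q ≋ (C ·ₚ reflect q') →
    (p +ₚ q) ≋ (C ·ₚ reflect (p' +ₚ q'))
  +ₚ-reflect C {p} {p'} {q} {q'} p≋ q≋ = begin
    p +ₚ q                                    ≈⟨ +ₚ-cong p≋ q≋ ⟩
    (C ·ₚ reflect p') +ₚ (C ·ₚ reflect q')    ≈⟨ ·ₚ-distrib-+ₚ C (reflect p') (reflect q') ⟨
    C ·ₚ (reflect p' +ₚ reflect q')           ≈⟨ ·ₚ-congˡ C (reflect-+ₚ p' q') ⟨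
    C ·ₚ reflect (p' +ₚ q')                   ∎
    where open ≋-Reasoning

  alternatingSum-reflect : {X : Set} (F G : Carrier → List X → Pol) (f g : Carrier → X → Pol) (C : Carrier) →
    (∀ s → F s [] ≡ []) → (∀ s → G s [] ≡ []) →
    (∀ s x xs → F s (x ∷ xs) ≡ (f s x +ₚ F (- s) xs)) →
    (∀ s x xs → G s (x ∷ xs) ≡ (g s x +ₚ G (- s) xs)) →
    (∀ s x → f s x ≋ (C ·ₚ reflect (g s x))) →
    ∀ s xs → F s xs ≋ (C ·ₚ reflect (G s xs))
  alternatingSum-reflect F G f g C F[] G[] F∷ G∷ f≋ s [] rewrite F[] s | G[] s = ≋-refl
  alternatingSum-reflect F G f g C F[] G[] F∷ G∷ f≋ s (x ∷ xs) rewrite F∷ s x xs | G∷ s x xs =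
    +ₚ-reflect C (f≋ s x) (alternatingSum-reflect F G f g C F[] G[] F∷ G∷ f≋ (- s) xs)

  det-reflect : ∀ m (M N : Fin m → Fin m → Pol) (a b : Fin m → Carrier) →
    (∀ i j → N i j ≋ ((a i * b j) ·ₚ reflect (M i j))) →
    det N ≋ ((∏ a * ∏ b) ·ₚ reflect (det M))
  det-reflect zero    M N a b N≋ = ∷-cong (sym (trans (*-identityʳ _) (*-identityʳ _))) ≋-refl
  det-reflect (suc m) M N a b N≋ = laplace
    where
      C : Carrier
      C = ∏ a * ∏ b
      term : (Fin (suc m) → Fin (suc m) → Pol) → Carrier → Fin (suc m) → Pol
      term A s j = s ·ₚ (A zero j *ₚ det (minor A j))
      term-reflect : ∀ s j → term N s j ≋ (C ·ₚ reflect (term M s j))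
      term-reflect s j = begin
        s ·ₚ (N zero j *ₚ det (minor N j))
          ≈⟨ ·ₚ-congˡ s (≋-trans (*ₚ-congˡ (det (minor N j)) (N≋ zero j)) (*ₚ-congʳ ((a₀ * bⱼ) ·ₚ reflect (M zero j)) minor≋)) ⟩
        s ·ₚ (((a₀ * bⱼ) ·ₚ reflect (M zero j)) *ₚ ((a' * b') ·ₚ reflect (det (minor M j))))
          ≈⟨ ·ₚ-congˡ s (*ₚ-·ₚ (a₀ * bⱼ) (a' * b') (reflect (M zero j)) (reflect (det (minor M j)))) ⟩
        s ·ₚ (((a₀ * bⱼ) * (a' * b')) ·ₚ (reflect (M zero j) *ₚ reflect (det (minor M j))))
          ≈⟨ ·ₚ-assoc s _ _ ⟩
        (s * ((a₀ * bⱼ) * (a' * b'))) ·ₚ (reflect (M zero j) *ₚ reflect (det (minor M j)))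
          ≈⟨ ·ₚ-cong scalars (≋-sym (reflect-*ₚ (M zero j) (det (minor M j)))) ⟩
        (C * s) ·ₚ reflect (M zero j *ₚ det (minor M j))
          ≈⟨ ·ₚ-assoc C s _ ⟨
        C ·ₚ (s ·ₚ reflect (M zero j *ₚ det (minor M j)))
          ≈⟨ ·ₚ-congˡ C (reflect-·ₚ s _) ⟨
        C ·ₚ reflect (term M s j)  ∎
        where
          open ≋-Reasoning
          a₀ bⱼ a' b' : Carrier
          a₀ = a zero
          bⱼ = b j
          a' = ∏ (λ i → a (suc i))
          b' = ∏ (λ k → b (punchIn j k))
          minor≋ : det (minor N j) ≋ ((a' * b') ·ₚ reflect (det (minor M j)))
          minor≋ = det-reflect m (minor M j) (minor N j) (λ i → a (suc i)) (λ k → b (punchIn j k))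
                     (λ i k → N≋ (suc i) (punchIn j k))
          scalars : s * ((a₀ * bⱼ) * (a' * b')) ≈ C * s
          scalars = trans (solve 5 (λ s a₀ bⱼ a' b' → s ⊕ ((a₀ ⊕ bⱼ) ⊕ (a' ⊕ b')) ⊜ ((a₀ ⊕ a') ⊕ (bⱼ ⊕ b')) ⊕ s) refl s a₀ bⱼ a' b')
                            (*-congʳ (*-congˡ (sym (sum-remove {i = j} b))))
            where open CommutativeMonoidSolver *-commutativeMonoid using (solve; _⊕_; _⊜_)
      -- det's local Laplace recursion, found by unification once the sign and the index list of its
      -- first recursive call are abstracted below.
      expandN expandM : Carrier → List (Fin (suc m)) → Pol
      expandN = _
      expandM = _
      laplace : det N ≋ (C ·ₚ reflect (det M))
      laplace with - 1# | tabulate {n = m} (λ k → suc {m} k)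
      ... | s | js = +ₚ-reflect C (term-reflect 1# zero) (alternatingSum-reflect expandN expandM (term N) (term M) C
        (λ _ → ≡.refl) (λ _ → ≡.refl) (λ _ _ _ → ≡.refl) (λ _ _ _ → ≡.refl) term-reflect s js)

  sign : Bool → Carrier
  sign true  = 1#
  sign false = - 1#

  -1*-1≈1 : (- 1#) * (- 1#) ≈ 1#
  -1*-1≈1 = trans (-1*x≈-x (- 1#)) (-‿involutive 1#)

  -sign*sign-≡ : ∀ {x y} → x ≡ y → (- sign x) * sign y ≈ - 1#
  -sign*sign-≡ {true}  ≡.refl = trans (sym (-‿distribˡ-* 1# 1#)) (-‿cong (*-identityˡ 1#))
  -sign*sign-≡ {false} ≡.refl = trans (sym (-‿distribˡ-* (- 1#) (- 1#))) (-‿cong -1*-1≈1)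

  -sign*sign-≢ : ∀ {x y} → ¬ x ≡ y → (- sign x) * sign y ≈ 1#
  -sign*sign-≢ {true}  {true}  x≢y = ⊥-elim (x≢y ≡.refl)
  -sign*sign-≢ {true}  {false} x≢y = -1*-1≈1
  -sign*sign-≢ {false} {true}  x≢y = trans (*-identityʳ _) (-‿involutive 1#)
  -sign*sign-≢ {false} {false} x≢y = ⊥-elim (x≢y ≡.refl)

  ≈0⇒≈* : ∀ {x} κ → x ≈ 0# → x ≈ κ * x
  ≈0⇒≈* κ x≈0 = trans x≈0 (sym (trans (*-congˡ x≈0) (zeroʳ κ)))

  -fromℕ0≈0 : ∀ {n} → n ≡ 0 → - fromℕ n ≈ 0#
  -fromℕ0≈0 ≡.refl = -0#≈0#

  charPoly-reflect : ∀ {m} (A : Fin m → Fin m → ℕ) (colour : Fin m → Bool) → Bipartite A colour →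
    Σ Carrier λ C → charPoly A ≋ (C ·ₚ reflect (charPoly A))
  charPoly-reflect {m} A colour bipartite = C , χ≋
    where
      a b : Fin m → Carrier
      a i = - sign (colour i)
      b j = sign (colour j)
      C : Carrier
      C = ∏ a * ∏ b
      -- E is solved by unification against charPoly A, yielding its local entry function.
      E : Fin m → Fin m → Pol
      E = _
      E≋ : ∀ i j → E i j ≋ ((a i * b j) ·ₚ reflect (E i j))
      χ≋ : charPoly A ≋ (C ·ₚ reflect (charPoly A))
      χ≋ = det-reflect m E E a b E≋
      E≋ i j with i Fin.≟ j
      ... | yes ≡.refl = ∷-cong (≈0⇒≈* _ (-fromℕ0≈0 (bipartite i i ≡.refl)))
        (∷-cong (sym (trans (*-cong (-sign*sign-≡ {colour i} ≡.refl) (*-identityʳ _)) -1*-1≈1)) ≋-refl)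
      ... | no _ with colour i Bool.≟ colour j
      ...   | yes same = ∷-cong (≈0⇒≈* _ (-fromℕ0≈0 (bipartite i j same))) ≋-refl
      ...   | no differ = ∷-cong (sym (trans (*-congʳ (-sign*sign-≢ differ)) (*-identityˡ _))) ≋-refl

  X-cong : ∀ {a b} → a ≈ b → (X- a) ≋ (X- b)
  X-cong a≈b = ∷-cong (-‿cong a≈b) ≋-refl

  eigenvalue-neg : ∀ {m} (A : Fin m → Fin m → ℕ) (colour : Fin m → Bool) → Bipartite A colour →
    ∀ a k → EigenvalueWithMultiplicity A a k → EigenvalueWithMultiplicity A (- a) k
  eigenvalue-neg A colour bipartite a k (1≤k , divides , ¬divides) with charPoly-reflect A colour bipartite
  ... | C , χ≋ = 1≤k , ∣ₚ-reflect C χ≋ a k divides , λ divides' →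
    ¬divides (∣ₚ-respˡ {p = charPoly A} (^ₚ-cong (suc k) (X-cong (-‿involutive a)))
                                       (∣ₚ-reflect C χ≋ (- a) (suc k) divides'))

open import Data.Nat using (_+_; _≤_; _<_; _⊓_; _⊔_; z≤n; s≤s)
import Data.Nat.Properties as ℕ
open import Data.List using (_++_; [_]; length; foldr; allFin; _ʳ++_)
open import Data.List.Relation.Unary.Linked using (Linked; []; [-]; _∷_)
import Data.List.Relation.Unary.Linked as Linked
open import Data.List.Relation.Unary.All as All using (All; []; _∷_)
open import Data.List.Relation.Unary.All.Properties using (¬Any⇒All¬; ++⁻ˡ; ++⁻ʳ)
open import Data.List.Relation.Unary.Any using (here; there)
open import Data.List.Relation.Unary.Unique.Propositional using (Unique)
open import Data.List.Relation.Unary.AllPairs using ([]; _∷_)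
open import Data.List.Membership.Propositional using (_∈_)
open import Data.List.Membership.Propositional.Properties using (∈-allFin; ∈-∃++)
open import Data.Product using (∃; proj₁; proj₂)
open import Data.Sum using (_⊎_; inj₁; inj₂)
open import Data.Unit using (⊤; tt)
open import Relation.Nullary using (Dec; does)
open import Relation.Binary.Core using (Rel)
open import Relation.Binary.Definitions using (Symmetric)
open import Relation.Binary.PropositionalEquality using (_≢_; refl; sym; trans; cong; cong₂; subst; subst₂; module ≡-Reasoning)
open import Function using (_∘_)

sum-bounds-tight : ∀ {p q r} → suc (r + r) ≤ p + q → p ≤ r → q ≤ suc r → p ≡ r × q ≡ suc r
sum-bounds-tight {p} {q} {r} 2r+1≤p+q p≤r q≤1+r = ℕ.≤-antisym p≤r r≤p , ℕ.≤-antisym q≤1+r 1+r≤q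
  where
    1+r≤q : suc r ≤ q
    1+r≤q = ℕ.≰⇒> λ q≤r → ℕ.<-irrefl refl (ℕ.≤-trans 2r+1≤p+q (ℕ.+-mono-≤ p≤r q≤r))
    r≤p : r ≤ p
    r≤p = ℕ.+-cancelʳ-≤ r r p (ℕ.≤-pred (ℕ.≤-trans 2r+1≤p+q
            (ℕ.≤-trans (ℕ.+-monoʳ-≤ p q≤1+r) (ℕ.≤-reflexive (ℕ.+-suc p r)))))

≤-of-≡suc : ∀ {l m k} → l ≡ m → k ≡ suc m → l ≤ k
≤-of-≡suc refl refl = ℕ.n≤1+n _

odd⇒suc-double : ∀ {k} → Odd k → ∃ λ r → k ≡ suc (r + r)
odd⇒suc-double (odd m) = m , cong (λ t → suc (m + t)) (ℕ.+-identityʳ m)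

module _ {A : Set} where

  end : A → List A → A
  end x []       = x
  end x (y ∷ ys) = end y ys

  end-∈ : ∀ y ys → end y ys ∈ y ∷ ys
  end-∈ y []       = here refl
  end-∈ y (z ∷ zs) = there (end-∈ z zs)

  NonBacktracking : List A → Set
  NonBacktracking (x ∷ y ∷ z ∷ zs) = x ≢ z × NonBacktracking (y ∷ z ∷ zs)
  NonBacktracking _                = ⊤

  nonBacktracking-tail : ∀ {x} xs → NonBacktracking (x ∷ xs) → NonBacktracking xs
  nonBacktracking-tail []           _        = tt
  nonBacktracking-tail (y ∷ [])     _        = tt
  nonBacktracking-tail (y ∷ z ∷ zs) (_ , nb) = nb

  unique-prefix : ∀ (ws : List A) {x} rest → Unique (ws ++ x ∷ rest) → Unique (x ∷ ws)
  unique-prefix []       rest _         = [] ∷ []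
  unique-prefix (w ∷ ws) rest (w∉ ∷ u) with unique-prefix ws rest u
  ... | x∉ws ∷ uws with ++⁻ʳ ws w∉
  ...   | w≢x ∷ _ = ((λ x≡w → w≢x (sym x≡w)) ∷ x∉ws) ∷ ++⁻ˡ ws w∉ ∷ uws

  linked-prefix : ∀ {ℓ} {R : Rel A ℓ} (as : List A) {b} bs → Linked R (as ++ b ∷ bs) → Linked R (as ++ [ b ])
  linked-prefix []            bs _        = [-]
  linked-prefix (x ∷ [])      bs (r ∷ _)  = r ∷ [-]
  linked-prefix (x ∷ y ∷ as)  bs (r ∷ l)  = r ∷ linked-prefix (y ∷ as) bs l

  ʳ++-shape : ∀ u hs acc → Σ (List A) λ t → hs ʳ++ (u ∷ acc) ≡ end u hs ∷ t ×
    (∀ {w} → w ∈ acc → w ∈ t) × length t ≡ length hs + length acc × end (end u hs) t ≡ end u acc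
  ʳ++-shape u []       acc = acc , refl , (λ w∈ → w∈) , refl , refl
  ʳ++-shape u (h ∷ hs) acc with ʳ++-shape h hs (u ∷ acc)
  ... | t , eq , ⊆t , len , ends = t , eq , (λ w∈ → ⊆t (there w∈)) , trans len (ℕ.+-suc (length hs) (length acc)) , ends

  ʳ++-linked : ∀ {ℓ} {R : Rel A ℓ} → Symmetric R →
    ∀ u hs acc → Linked R (u ∷ hs) → Linked R (u ∷ acc) → Linked R (hs ʳ++ (u ∷ acc))
  ʳ++-linked sym-R u []       acc _       l = l
  ʳ++-linked sym-R u (h ∷ hs) acc (r ∷ l) l' = ʳ++-linked sym-R h hs (u ∷ acc) l (sym-R r ∷ l')

  DistinctHeads : List A → List A → Set
  DistinctHeads (h ∷ _) (b ∷ _) = h ≢ b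
  DistinctHeads _       _       = ⊤

  ʳ++-nonBacktracking : ∀ u hs acc → NonBacktracking (u ∷ hs) → NonBacktracking (u ∷ acc) →
    DistinctHeads hs acc → NonBacktracking (hs ʳ++ (u ∷ acc))
  ʳ++-nonBacktracking u []       acc _  nb _  = nb
  ʳ++-nonBacktracking u (h ∷ hs) acc nb nb' h≢ =
    ʳ++-nonBacktracking h hs (u ∷ acc) (nonBacktracking-tail (h ∷ hs) nb) (extend acc nb' h≢) (heads hs nb)
    where
      extend : ∀ acc → NonBacktracking (u ∷ acc) → DistinctHeads (h ∷ hs) acc → NonBacktracking (h ∷ u ∷ acc)
      extend []      _   _  = tt
      extend (_ ∷ _) nb' h≢ = h≢ , nb'
      heads : ∀ hs → NonBacktracking (u ∷ h ∷ hs) → DistinctHeads hs (u ∷ acc)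
      heads []      _        = tt
      heads (_ ∷ _) (u≢ , _) = λ eq → u≢ (sym eq)

  cons-nonBacktracking : ∀ p q qs → DistinctHeads qs [ p ] → NonBacktracking (q ∷ qs) → NonBacktracking (p ∷ q ∷ qs)
  cons-nonBacktracking p q []       _   _  = tt
  cons-nonBacktracking p q (r ∷ qs) r≢p nb = (λ p≡r → r≢p (sym p≡r)) , nb

module _ {A : Set} where

  max-≥ : ∀ (f : A → ℕ) xs {v} → v ∈ xs → f v ≤ foldr (λ w m → f w ⊔ m) 0 xs
  max-≥ f (w ∷ ws) (here refl) = ℕ.m≤m⊔n (f w) _
  max-≥ f (w ∷ ws) (there v∈) = ℕ.≤-trans (max-≥ f ws v∈) (ℕ.m≤n⊔m (f w) _)

  max-attained : ∀ (f : A → ℕ) xs → let m = foldr (λ w m → f w ⊔ m) 0 xs in m ≡ 0 ⊎ ∃ λ v → m ≡ f v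
  max-attained f []       = inj₁ refl
  max-attained f (w ∷ ws) with ℕ.⊔-sel (f w) (foldr (λ w m → f w ⊔ m) 0 ws)
  ... | inj₁ eq = inj₂ (w , eq)
  ... | inj₂ eq with max-attained f ws
  ...   | inj₁ eq' = inj₁ (trans eq eq')
  ...   | inj₂ (v , eq') = inj₂ (v , trans eq eq')

module _ {n : ℕ} (d : Fin n → Fin n → ℕ) where

  ecc-≥ : ∀ u v → d u v ≤ ecc d u
  ecc-≥ u v = max-≥ (d u) (allFin n) (∈-allFin v)

  ecc≤diam : ∀ u → ecc d u ≤ diam d
  ecc≤diam u = max-≥ (ecc d) (allFin n) (∈-allFin u)

  diameter-attained : diam d ≢ 0 → ∃ λ x → ∃ λ y → d x y ≡ diam d
  diameter-attained diam≢0 with max-attained (ecc d) (allFin n)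
  ... | inj₁ diam≡0 = ⊥-elim (diam≢0 diam≡0)
  ... | inj₂ (x , diam≡ecc) with max-attained (d x) (allFin n)
  ...   | inj₁ ecc≡0 = ⊥-elim (diam≢0 (trans diam≡ecc ecc≡0))
  ...   | inj₂ (y , ecc≡d) = x , y , sym (trans diam≡ecc ecc≡d)

  eccMat-zero : ∀ u v → d u v < ecc d u ⊓ ecc d v → eccMat d u v ≡ 0
  eccMat-zero u v lt with d u v ℕ.≟ (ecc d u ⊓ ecc d v)
  ... | yes eq = ⊥-elim (ℕ.<-irrefl eq lt)
  ... | no _   = refl

module Forest {n : ℕ} (G : SimpleGraph n) (acyclic : Acyclic G)
  (d : Fin n → Fin n → ℕ) (isDistance : IsDistance G d) where

  open import Data.List.Membership.DecPropositional (Fin._≟_ {n}) using (_∈?_)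

  V : Set
  V = Fin n

  _~_ : V → V → Set
  _~_ = Adj G

  nonBacktracking⇒unique : ∀ xs → Linked _~_ xs → NonBacktracking xs → Unique xs
  nonBacktracking⇒unique []       _ _  = []
  nonBacktracking⇒unique (x ∷ xs) l nb
    with nonBacktracking⇒unique xs (Linked.tail l) (nonBacktracking-tail xs nb) | x ∈? xs
  ... | uniq | no x∉xs = ¬Any⇒All¬ xs x∉xs ∷ uniq
  ... | uniq | yes x∈xs with ∈-∃++ x∈xs
  ...   | ws , rest , refl = ⊥-elim (acyclic (x ∷ ws)
          (cycle-length ws l nb , unique-prefix ws rest uniq , linked-prefix (x ∷ ws) rest l))
    where
      cycle-length : ∀ ws → Linked _~_ (x ∷ ws ++ x ∷ rest) → NonBacktracking (x ∷ ws ++ x ∷ rest) → 2 ≤ length ws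
      cycle-length []           (x~x ∷ _) _        = ⊥-elim (irrefl G x~x)
      cycle-length (w ∷ [])     _         (x≢x , _) = ⊥-elim (x≢x refl)
      cycle-length (w ∷ w' ∷ _) _         _        = s≤s (s≤s z≤n)

  record Path (u v : V) (k : ℕ) : Set where
    constructor path
    field
      hops    : List V
      linked  : Linked _~_ (u ∷ hops)
      reaches : end u hops ≡ v
      length≡ : length hops ≡ k

  toWalk : ∀ u xs → Linked _~_ (u ∷ xs) → Walk G u (end u xs) (length xs)
  toWalk u []       _       = nil
  toWalk u (y ∷ ys) (r ∷ l) = cons r (toWalk y ys l)

  toPath : ∀ {u v k} → Walk G u v k → Path u v k
  toPath nil = path [] [-] refl refl
  toPath (cons r w) with toPath w
  ... | path xs l e len = path (_ ∷ xs) (r ∷ l) e (cong suc len)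

  shortestPath : ∀ u v → Path u v (d u v)
  shortestPath u v = toPath (proj₁ (isDistance u v))

  d≤walk : ∀ {u v k} → Walk G u v k → d u v ≤ k
  d≤walk {u} {v} {k} w = proj₂ (isDistance u v) k w

  d≤length : ∀ u xs → Linked _~_ (u ∷ xs) → d u (end u xs) ≤ length xs
  d≤length u xs l = d≤walk (toWalk u xs l)

  d≤path : ∀ {u v k} → Path u v k → d u v ≤ k
  d≤path {u} (path xs l refl refl) = d≤length u xs l

  -- If the path stepped to q first, q would be strictly closer to z than length hs.
  second≢ : ∀ {p q z} hs → Linked _~_ (p ∷ hs) → end p hs ≡ z → length hs ≤ d q z →
    ∀ {rest} → DistinctHeads hs (q ∷ rest)
  second≢ []       _       _  _  = tt
  second≢ (h ∷ hs) (_ ∷ l) ends ≤d refl =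
    ℕ.<-irrefl refl (ℕ.≤-trans (s≤s (d≤path (path hs l ends refl))) ≤d)

  nonBacktracking-or-shortcut : ∀ x xs → Linked _~_ (x ∷ xs) →
    NonBacktracking (x ∷ xs) ⊎ Σ (List V) λ ys → Linked _~_ (x ∷ ys) × end x ys ≡ end x xs × suc (suc (length ys)) ≡ length xs
  nonBacktracking-or-shortcut x []           _       = inj₁ tt
  nonBacktracking-or-shortcut x (y ∷ [])     _       = inj₁ tt
  nonBacktracking-or-shortcut x (y ∷ z ∷ zs) (r ∷ l) with x Fin.≟ z
  ... | yes refl = inj₂ (zs , Linked.tail l , refl , refl)
  ... | no x≢z with nonBacktracking-or-shortcut y (z ∷ zs) l
  ...   | inj₁ nb = inj₁ (x≢z , nb)
  ...   | inj₂ (ys , l' , ends , len) = inj₂ (y ∷ ys , r ∷ l' , ends , cong suc len)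

  shortest⇒nonBacktracking : ∀ {u v} (P : Path u v (d u v)) → NonBacktracking (u ∷ Path.hops P)
  shortest⇒nonBacktracking {u} (path xs l ends len) with nonBacktracking-or-shortcut u xs l
  ... | inj₁ nb = nb
  ... | inj₂ (ys , l' , ends' , len') = ⊥-elim (ℕ.<-irrefl refl (begin-strict
    d u _                  ≤⟨ d≤path (path ys l' (trans ends' ends) refl) ⟩
    length ys              ≤⟨ ℕ.n≤1+n _ ⟩
    suc (length ys)        <⟨ ℕ.n<1+n _ ⟩
    suc (suc (length ys))  ≡⟨ trans len' len ⟩
    d u _                  ∎))
    where open ℕ.≤-Reasoning

  -- In a forest a walk that never immediately returns is a shortest walk: otherwise a shortest walk
  -- back from its end closes up into a non-backtracking closed walk, which must contain a cycle.
  nonBacktracking⇒shortest : ∀ x xs → Linked _~_ (x ∷ xs) → NonBacktracking (x ∷ xs) → d x (end x xs) ≡ length xs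
  nonBacktracking⇒shortest x []       l       nb = ℕ.n≤0⇒n≡0 (d≤length x [] l)
  nonBacktracking⇒shortest x (y ∷ ys) (r ∷ l) nb =
    ℕ.≤-antisym (d≤length x (y ∷ ys) (r ∷ l)) (ℕ.≰⇒> not-shorter)
    where
      u : V
      u = end y ys
      d-y-u : d y u ≡ length ys
      d-y-u = nonBacktracking⇒shortest y ys l (nonBacktracking-tail (y ∷ ys) nb)
      not-shorter : ¬ d x u ≤ length ys
      not-shorter short with shortestPath x u
      ... | P@(path hs lh ends len) with ʳ++-shape x hs (y ∷ ys)
      ...   | t , eq , ⊆t , _ , _ with subst Unique eq (nonBacktracking⇒unique (hs ʳ++ (x ∷ y ∷ ys)) closed-linked closed-nb)
        where
          closed-linked : Linked _~_ (hs ʳ++ (x ∷ y ∷ ys))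
          closed-linked = ʳ++-linked (SimpleGraph.sym G) x hs (y ∷ ys) lh (r ∷ l)
          closed-nb : NonBacktracking (hs ʳ++ (x ∷ y ∷ ys))
          closed-nb = ʳ++-nonBacktracking x hs (y ∷ ys) (shortest⇒nonBacktracking P) nb
            (second≢ {q = y} hs lh ends (subst₂ _≤_ (sym len) (sym d-y-u) short))
      ...     | u∉t ∷ _ = All.lookup u∉t (⊆t (end-∈ y ys)) ends

  d-sym≤ : ∀ u v → d u v ≤ d v u
  d-sym≤ u v with shortestPath v u
  ... | path xs l ends len with ʳ++-shape v xs []
  ...   | t , eq , _ , len' , ends' = begin
    d u v                            ≡⟨ cong₂ d (sym ends) (sym ends') ⟩
    d (end v xs) (end (end v xs) t)  ≤⟨ d≤length (end v xs) t (subst (Linked _~_) eq reversed) ⟩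
    length t                         ≡⟨ trans len' (trans (ℕ.+-identityʳ (length xs)) len) ⟩
    d v u                            ∎
    where
      open ℕ.≤-Reasoning
      reversed : Linked _~_ (xs ʳ++ [ v ])
      reversed = ʳ++-linked (SimpleGraph.sym G) v xs [] l [-]

  d-sym : ∀ u v → d u v ≡ d v u
  d-sym u v = ℕ.≤-antisym (d-sym≤ u v) (d-sym≤ v u)

  _++ʷ_ : ∀ {u w v k l} → Walk G u w k → Walk G w v l → Walk G u v (k + l)
  nil      ++ʷ w' = w'
  cons r w ++ʷ w' = cons r (w ++ʷ w')

  triangle : ∀ u w v → d u v ≤ d u w + d w v
  triangle u w v = d≤walk (proj₁ (isDistance u w) ++ʷ proj₁ (isDistance w v))

  distinctHeads? : ∀ (gs : List V) q → DistinctHeads gs [ q ] ⊎ ∃ λ gs' → gs ≡ q ∷ gs'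
  distinctHeads? []       q = inj₁ tt
  distinctHeads? (g ∷ gs) q with g Fin.≟ q
  ... | yes refl = inj₂ (gs , refl)
  ... | no g≢q   = inj₁ g≢q

  adjacent-sides : ∀ {a b} → a ~ b → ∀ w → d b w ≡ suc (d a w) ⊎ d a w ≡ suc (d b w)
  adjacent-sides {a} {b} a~b w with shortestPath a w
  ... | P@(path gs lg ends len) with distinctHeads? gs b
  ...   | inj₁ g≢b = inj₁ (begin
    d b w                ≡⟨ cong (d b) (sym ends) ⟩
    d b (end a gs)       ≡⟨ nonBacktracking⇒shortest b (a ∷ gs) (SimpleGraph.sym G a~b ∷ lg)
                              (cons-nonBacktracking b a gs g≢b (shortest⇒nonBacktracking P)) ⟩
    suc (length gs)      ≡⟨ cong suc len ⟩
    suc (d a w)          ∎)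
    where open ≡-Reasoning
  ...   | inj₂ (gs' , refl) = inj₂ (begin
    d a w                ≡⟨ len ⟨
    suc (length gs')     ≡⟨ cong suc (nonBacktracking⇒shortest b gs' (Linked.tail lg)
                              (nonBacktracking-tail (b ∷ gs') (shortest⇒nonBacktracking P))) ⟨
    suc (d b (end b gs')) ≡⟨ cong (suc ∘ d b) ends ⟩
    suc (d b w)          ∎)
    where open ≡-Reasoning

  -- The reversed shortest walk from p to w, the edge p q and a shortest walk from q to z form a
  -- non-backtracking walk.
  across-edge : ∀ {p q} → p ~ q → ∀ w z → d q w ≡ suc (d p w) → d p z ≡ suc (d q z) →
    d w z ≡ d p w + suc (d q z)
  across-edge {p} {q} p~q w z w-side z-side with shortestPath p w | shortestPath q z
  ... | P@(path hs lh endsh lenh) | Q@(path qs lq endsq lenq) with ʳ++-shape p hs (q ∷ qs)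
  ...   | t , eq , _ , lent , endst = begin
    d w z                            ≡⟨ cong₂ d (sym endsh) (trans (sym endsq) (sym endst)) ⟩
    d (end p hs) (end (end p hs) t)  ≡⟨ nonBacktracking⇒shortest (end p hs) t (subst (Linked _~_) eq linked) (subst NonBacktracking eq nb) ⟩
    length t                         ≡⟨ lent ⟩
    length hs + suc (length qs)      ≡⟨ cong₂ (λ i j → i + suc j) lenh lenq ⟩
    d p w + suc (d q z)              ∎
    where
      open ≡-Reasoning
      linked : Linked _~_ (hs ʳ++ (p ∷ q ∷ qs))
      linked = ʳ++-linked (SimpleGraph.sym G) p hs (q ∷ qs) lh (p~q ∷ lq)
      nb : NonBacktracking (hs ʳ++ (p ∷ q ∷ qs))
      nb = ʳ++-nonBacktracking p hs (q ∷ qs) (shortest⇒nonBacktracking P)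
             (cons-nonBacktracking p q qs (second≢ qs lq endsq (≤-of-≡suc lenq z-side)) (shortest⇒nonBacktracking Q))
             (second≢ hs lh endsh (≤-of-≡suc lenh w-side))

  splitʷ : ∀ k {l u v} → Walk G u v (k + l) → ∃ λ w → Walk G u w k × Walk G w v l
  splitʷ zero    {u = u} W = u , nil , W
  splitʷ (suc k) (cons r W) with splitʷ k W
  ... | w , W₁ , W₂ = w , cons r W₁ , W₂

  same-side-close : ∀ {p q f r} → p ~ q → d p f ≡ suc (d q f) → d q f ≡ r → (∀ v → d v f ≤ suc (r + r)) →
    ∀ u v → d q u ≡ suc (d p u) → d q v ≡ suc (d p v) → d u v < ecc d u
  same-side-close {p} {q} {f} {r} p~q f-side d-q-f bounded u v u-side v-side = begin-strict
    d u v              ≤⟨ triangle u p v ⟩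
    d u p + d p v      ≤⟨ ℕ.+-mono-≤ (ℕ.≤-reflexive (d-sym u p)) d-p-v≤r ⟩
    d p u + r          <⟨ ℕ.+-monoʳ-< (d p u) (ℕ.n<1+n r) ⟩
    d p u + suc r      ≡⟨ far u u-side ⟨
    d u f              ≤⟨ ecc-≥ d u f ⟩
    ecc d u            ∎
    where
      open ℕ.≤-Reasoning
      far : ∀ w → d q w ≡ suc (d p w) → d w f ≡ d p w + suc r
      far w w-side = trans (across-edge p~q w f w-side f-side) (cong (λ i → d p w + suc i) d-q-f)
      d-p-v≤r : d p v ≤ r
      d-p-v≤r = ℕ.+-cancelʳ-≤ (suc r) (d p v) r (subst₂ _≤_ (far v v-side) (sym (ℕ.+-suc r r)) (bounded v))

  same-side-close-both : ∀ {p q f r} → p ~ q → d p f ≡ suc (d q f) → d q f ≡ r → (∀ v → d v f ≤ suc (r + r)) →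
    ∀ u v → d q u ≡ suc (d p u) → d q v ≡ suc (d p v) → d u v < ecc d u ⊓ ecc d v
  same-side-close-both p~q f-side d-q-f bounded u v u-side v-side = ℕ.⊓-glb
    (same-side-close p~q f-side d-q-f bounded u v u-side v-side)
    (subst (_< ecc d v) (d-sym v u) (same-side-close p~q f-side d-q-f bounded v u v-side u-side))

  record CentralEdge (r : ℕ) : Set where
    field
      {a b x y} : V
      a~b   : a ~ b
      d-a-x : d a x ≡ r
      d-b-x : d b x ≡ suc (d a x)
      d-b-y : d b y ≡ r
      d-a-y : d a y ≡ suc (d b y)

  -- The middle edge of a shortest walk of length 2r+1.
  centralEdge : ∀ {x y r} → d x y ≡ suc (r + r) → CentralEdge r
  centralEdge {x} {y} {r} d-x-y
    with splitʷ r (subst (Walk G x y) (trans d-x-y (sym (ℕ.+-suc r r))) (proj₁ (isDistance x y)))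
  ... | a , W₁ , cons {w = b} a~b W₃ = record
    { a~b   = a~b
    ; d-a-x = d-a-x
    ; d-b-x = trans (d-sym b x) (trans (proj₂ b-tight) (cong suc (sym d-a-x)))
    ; d-b-y = proj₁ b-tight
    ; d-a-y = trans (proj₂ a-tight) (cong suc (sym (proj₁ b-tight)))
    }
    where
      a-tight : d x a ≡ r × d a y ≡ suc r
      a-tight = sum-bounds-tight (subst (_≤ d x a + d a y) d-x-y (triangle x a y))
        (d≤walk W₁) (d≤walk (cons a~b W₃))
      b-tight : d b y ≡ r × d x b ≡ suc r
      b-tight = sum-bounds-tight (subst₂ _≤_ d-x-y (ℕ.+-comm (d x b) (d b y)) (triangle x b y))
        (d≤walk W₃) (d≤walk (subst (Walk G x b) (ℕ.+-comm r 1) (W₁ ++ʷ cons a~b nil)))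
      d-a-x : d a x ≡ r
      d-a-x = trans (d-sym a x) (proj₁ a-tight)

  oddDiameter⇒bipartite : Odd (diam d) → Σ (V → Bool) (Bipartite (eccMat d))
  oddDiameter⇒bipartite odd-diam with odd⇒suc-double odd-diam
  ... | r , diam≡ with diameter-attained d (λ diam≡0 → ℕ.0≢1+n (trans (sym diam≡0) diam≡))
  ...   | _ , _ , diametral = colour , bipartite
    where
      open CentralEdge (centralEdge {r = r} (trans diametral diam≡))
      bounded : ∀ f v → d v f ≤ suc (r + r)
      bounded f v = ℕ.≤-trans (ecc-≥ d v f) (ℕ.≤-trans (ecc≤diam d v) (ℕ.≤-reflexive diam≡))
      colour : V → Bool
      colour w = does (d b w ℕ.≟ suc (d a w))
      b-side : ∀ w → d b w ≢ suc (d a w) → d a w ≡ suc (d b w)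
      b-side w not-a-side with adjacent-sides a~b w
      ... | inj₁ a-side = ⊥-elim (not-a-side a-side)
      ... | inj₂ closer-to-b = closer-to-b
      bipartite : Bipartite (eccMat d) colour
      bipartite i j same = eccMat-zero d i j (close (d b i ℕ.≟ suc (d a i)) (d b j ℕ.≟ suc (d a j)) same)
        where
          close : (i? : Dec (d b i ≡ suc (d a i))) (j? : Dec (d b j ≡ suc (d a j))) → does i? ≡ does j? →
            d i j < ecc d i ⊓ ecc d j
          close (yes i-a) (yes j-a) _ = same-side-close-both a~b d-a-y d-b-y (bounded y) i j i-a j-a
          close (no i-b)  (no j-b)  _ =
            same-side-close-both (SimpleGraph.sym G a~b) d-b-x d-a-x (bounded x) i j (b-side i i-b) (b-side j j-b)

theorem4p1 : {c ℓ : Level} (K : Field c ℓ) → Poly.CharZero K →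
    (n : ℕ) (T : SimpleGraph n) → IsTree T →
    (d : Fin n → Fin n → ℕ) → IsDistance T d →
    Odd (diam d) →
    (λ₀ : Field.Carrier K) (k : ℕ) →
    Poly.EigenvalueWithMultiplicity K (eccMat d) λ₀ k →
    Poly.EigenvalueWithMultiplicity K (eccMat d) (Field.-_ K λ₀) k
-- Neither the characteristic nor connectedness matters: the symmetry is a polynomial identity, and only
-- acyclicity of the tree enters the distance arguments.
theorem4p1 K _ n T (_ , acyclic) d isDistance odd-diam λ₀ k eigenvalue
  with Forest.oddDiameter⇒bipartite T acyclic d isDistance odd-diam
... | colour , bipartite = Polynomials.eigenvalue-neg K (eccMat d) colour bipartite λ₀ k eigenvalue
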